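{- Let $\mathcal D$ be an $s$-bounded abstract system of proof notations. Then for every $d\in\mathrm{Ecl}(\mathcal D)$ we have $|d|\le\vartheta_d(s)$.
   Context: An abstract system of proof notations is a set $\mathcal D$ together with two functions $|\cdot|,\|\cdot\|\colon\mathcal D\to\mathbb N\setminus\{0\}$ ("size" and "height") and a relation $\to\,\subseteq\mathcal D\times\mathcal D$ such that $d\to d'$ implies $\|d'\|<\|d\|$. $\mathcal D$ is $s$-bounded if $|d|\le s$ for all $d\in\mathcal D$. The cut elimination closure $\mathrm{Ecl}(\mathcal D)$ is defined inductively, with new symbols $\mathsf I,\mathsf R,\mathsf E$: every $d\in\mathcal D$ is in $\mathrm{Ecl}(\mathcal D)$ (with its size and height); if $d,e\in\mathrm{Ecl}(\mathcal D)$ then $\mathsf I d,\ \mathsf R de,\ \mathsf E d\in\mathrm{Ecl}(\mathcal D)$, with $|\mathsf I d|=|d|+1$, $|\mathsf R de|=|d|+|e|+1$, $|\mathsf E d|=|d|+1$, and $\|\mathsf I d\|=\|d\|$, $\|\mathsf R de\|=\|d\|+\|e\|$, $\|\mathsf E d\|=2^{\|d\|}-1$. Size functions: to each $d\in\mathrm{Ecl}(\mathcal D)$ a monotone function $\vartheta_d\colon\mathbb N\to\mathbb N$ is assigned by recursion: $\vartheta_d(s)=s$ for $d\in\mathcal D$; $\vartheta_{\mathsf I d}(s)=\vartheta_d(s)+1$; $\vartheta_{\mathsf R de}(s)=\max\{|d|+1+\vartheta_e(s),\ \vartheta_d(s)+1\}$; $\vartheta_{\mathsf E d}(s)=\|d\|\cdot(\vartheta_d(s)+2)$.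 -}

module Defs where

open import Level using (Level)
open import Data.Nat using (ℕ; _+_; _*_; _∸_; _^_; _≤_; _<_; _⊔_)
  renaming (suc to sucℕ)
open import Relation.Binary using (Rel)

record APN (a r : Level) : Set (Level.suc (a Level.⊔ r)) where
  field
    Carrier  : Set a
    size     : Carrier → ℕ
    height   : Carrier → ℕ
    size-pos   : ∀ d → 1 ≤ size d
    height-pos : ∀ d → 1 ≤ height d
    _⟶_      : Rel Carrier r
    ⟶-height : ∀ {d d'} → d ⟶ d' → height d' < height d

Bounded : ∀ {a r} → APN a r → ℕ → Set a
Bounded 𝒟 s = ∀ d → APN.size 𝒟 d ≤ s

data Ecl {a r} (𝒟 : APN a r) : Set a where
  base : APN.Carrier 𝒟 → Ecl 𝒟
  I    : Ecl 𝒟 → Ecl 𝒟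
  R    : Ecl 𝒟 → Ecl 𝒟 → Ecl 𝒟
  E    : Ecl 𝒟 → Ecl 𝒟

module _ {a r} {𝒟 : APN a r} where

  ∣_∣ : Ecl 𝒟 → ℕ
  ∣ base d ∣ = APN.size 𝒟 d
  ∣ I d ∣    = ∣ d ∣ + 1
  ∣ R d e ∣  = ∣ d ∣ + ∣ e ∣ + 1
  ∣ E d ∣    = ∣ d ∣ + 1

  ‖_‖ : Ecl 𝒟 → ℕ
  ‖ base d ‖ = APN.height 𝒟 d
  ‖ I d ‖    = ‖ d ‖
  ‖ R d e ‖  = ‖ d ‖ + ‖ e ‖
  ‖ E d ‖    = 2 ^ ‖ d ‖ ∸ 1

  ϑ : Ecl 𝒟 → ℕ → ℕ
  ϑ (base d) s = s
  ϑ (I d) s    = ϑ d s + 1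
  ϑ (R d e) s  = (∣ d ∣ + 1 + ϑ e s) ⊔ (ϑ d s + 1)
  ϑ (E d) s    = ‖ d ‖ * (ϑ d s + 2)

module Submission where

-- The proof is a structural induction on d ∈ Ecl(𝒟), one case per
-- constructor:
--   * base notations are bounded by s by hypothesis;
--   * 𝖨 adds one to both sides;
--   * for 𝖱 d e the first argument of the maximum, |d| + 1 + ϑ_e(s),
--     already dominates |d| + |e| + 1 by the bound for e;
--   * for 𝖤 d we use |d| + 1 ≤ ϑ_d(s) + 2 and multiply by the height ‖d‖,
--     which is legitimate because every element of Ecl(𝒟) has positive
--     height (heights in 𝒟 are positive, and 2^h − 1 ≥ 1 for h ≥ 1).

open import Defs
open import Data.Nat using (ℕ; _≤_; _+_; _*_; _^_; _∸_; >-nonZero)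
open import Data.Nat.Properties
open import Relation.Binary.PropositionalEquality using (cong)

2^-∸1-positive : ∀ {h} → 1 ≤ h → 1 ≤ 2 ^ h ∸ 1
2^-∸1-positive {h} 1≤h = ∸-monoˡ-≤ 1 (^-monoʳ-≤ 2 1≤h)

module _ {a r} {𝒟 : APN a r} where

  -- Every notation in the cut elimination closure has positive height;
  -- this is what makes multiplication by ‖d‖ size-increasing in the 𝖤 case.
  height-positive : (d : Ecl 𝒟) → 1 ≤ ‖ d ‖
  height-positive (base x) = APN.height-pos 𝒟 x
  height-positive (I d)    = height-positive d
  height-positive (R d e)  = ≤-trans (height-positive d) (m≤m+n ‖ d ‖ ‖ e ‖)
  height-positive (E d)    = 2^-∸1-positive (height-positive d)

  R-size-bound : ∀ (d e : Ecl 𝒟) {t} → ∣ e ∣ ≤ t → ∣ R d e ∣ ≤ ∣ d ∣ + 1 + t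
  R-size-bound d e {t} ∣e∣≤t = begin
    ∣ d ∣ + ∣ e ∣ + 1   ≡⟨ +-assoc ∣ d ∣ ∣ e ∣ 1 ⟩
    ∣ d ∣ + (∣ e ∣ + 1) ≡⟨ cong (∣ d ∣ +_) (+-comm ∣ e ∣ 1) ⟩
    ∣ d ∣ + (1 + ∣ e ∣) ≤⟨ +-monoʳ-≤ ∣ d ∣ (+-monoʳ-≤ 1 ∣e∣≤t) ⟩
    ∣ d ∣ + (1 + t)     ≡⟨ +-assoc ∣ d ∣ 1 t ⟨
    ∣ d ∣ + 1 + t       ∎
    where open ≤-Reasoning

  E-size-bound : ∀ (d : Ecl 𝒟) {t} → ∣ d ∣ ≤ t → ∣ E d ∣ ≤ ‖ d ‖ * (t + 2)
  E-size-bound d {t} ∣d∣≤t =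
    m≤n⇒m≤o*n ‖ d ‖ {{>-nonZero (height-positive d)}} ∣d∣+1≤t+2
    where
    ∣d∣+1≤t+2 : ∣ d ∣ + 1 ≤ t + 2
    ∣d∣+1≤t+2 = +-mono-≤ ∣d∣≤t (n≤1+n 1)

mainTheorem4 : ∀ {a r} (𝒟 : APN a r) (s : ℕ) → Bounded 𝒟 s →
    (d : Ecl 𝒟) → ∣ d ∣ ≤ ϑ d s
mainTheorem4 𝒟 s bounded (base x) = bounded x
mainTheorem4 𝒟 s bounded (I d)    = +-monoˡ-≤ 1 (mainTheorem4 𝒟 s bounded d)
mainTheorem4 𝒟 s bounded (R d e)  =
  ≤-trans (R-size-bound d e (mainTheorem4 𝒟 s bounded e)) (m≤m⊔n _ _)
mainTheorem4 𝒟 s bounded (E d)    = E-size-bound d (mainTheorem4 𝒟 s bounded d)
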